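{- Fix an integer $d\ge4$. There is a constant $C_d$ such that the following holds. Let $v$ be a vertex of a directed graph with in-degree $s$ and out-degree $r$, where $\max(s,r)>d$. After the Splitting Procedure with parameter $d$ is completed on $v$, the resulting subgraph replacing $v$ has at most $C_d\max(s,r)$ vertices and at most $C_d\max(s,r)$ edges; i.e. it has $O(\max(s,r))$ vertices and edges.
   Context: Directed graphs have no loops and no two arcs with the same tail and head. A split replaces a vertex $w$ by two vertices $p,q$ with the arc $(p,q)$; arcs into $w$ become arcs into $p$, arcs out of $w$ become arcs out of $q$. An in-split replaces $w$ by vertices $p,q,t$ with arcs $(p,q),(q,p),(p,t),(q,t)$; arcs into $w$ are divided between $p$ and $q$ with numbers differing by at most one; arcs out of $w$ become arcs out of $t$. An out-split replaces $w$ by vertices $p,q,t$ with arcs $(p,q),(p,t),(q,t),(t,q)$; arcs into $w$ become arcs into $p$; arcs out of $w$ are divided between $q$ and $t$ with numbers differing by at most one. Splitting Procedure for $v$ with parameter $d$: (i) replace $v$ with a split; (ii) while some vertex of the subgraph replacing $v$ has in-degree $>d$, replace it by an in-split; (iii) while some vertex of the subgraph replacing $v$ has out-degree $>d$, replace it by an out-split. -}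

module Defs where

open import Data.Nat using (ℕ; zero; suc; _+_; _*_; _≤_; _<_; _⊔_; _≡ᵇ_)
open import Data.Bool using (Bool; true; false; not; _∧_; if_then_else_)
open import Data.List using (List; []; _∷_; _++_; map; filterᵇ; length)
open import Data.List.Membership.Propositional using (_∈_; _∉_)
open import Data.List.Relation.Unary.All using (All)
open import Data.List.Relation.Unary.Unique.Propositional using (Unique)
open import Data.Product using (_×_; _,_; proj₁; proj₂; Σ; ∃; ∃-syntax)
open import Relation.Binary.PropositionalEquality using (_≡_; _≢_)

record Digraph : Set where
  constructor mkDigraph
  field
    V : List ℕ
    A : List (ℕ × ℕ)
open Digraph public

record WellFormed (G : Digraph) : Set where
  field
    uniqueV  : Unique (V G)
    uniqueA  : Unique (A G)
    tailsInV : All (λ a → proj₁ a ∈ V G) (A G)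
    headsInV : All (λ a → proj₂ a ∈ V G) (A G)
    noLoops  : All (λ a → proj₁ a ≢ proj₂ a) (A G)

countᵇ : {X : Set} → (X → Bool) → List X → ℕ
countᵇ p xs = length (filterᵇ p xs)

elemᵇ : ℕ → List ℕ → Bool
elemᵇ x []       = false
elemᵇ x (y ∷ ys) = if x ≡ᵇ y then true else elemᵇ x ys

removeᵇ : ℕ → List ℕ → List ℕ
removeᵇ w = filterᵇ (λ x → not (x ≡ᵇ w))

indeg : Digraph → ℕ → ℕ
indeg G w = countᵇ (λ a → proj₂ a ≡ᵇ w) (A G)

outdeg : Digraph → ℕ → ℕ
outdeg G w = countᵇ (λ a → proj₁ a ≡ᵇ w) (A G)

-- number of arcs of G with both ends in the vertex list S
-- (= number of arcs of the subgraph induced by S)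
arcsWithin : Digraph → List ℕ → ℕ
arcsWithin G S = countᵇ (λ a → elemᵇ (proj₁ a) S ∧ elemᵇ (proj₂ a) S) (A G)

split : Digraph → (w p q : ℕ) → Digraph
split G w p q = mkDigraph (removeᵇ w (V G) ++ p ∷ q ∷ [])
  ((p , q) ∷ map (λ a → ( (if proj₁ a ≡ᵇ w then q else proj₁ a)
                        , (if proj₂ a ≡ᵇ w then p else proj₂ a))) (A G))

inSplit : Digraph → (w p q t : ℕ) → (c : ℕ → Bool) → Digraph
inSplit G w p q t c = mkDigraph (removeᵇ w (V G) ++ p ∷ q ∷ t ∷ [])
  ((p , q) ∷ (q , p) ∷ (p , t) ∷ (q , t) ∷
   map (λ a → ( (if proj₁ a ≡ᵇ w then t else proj₁ a)
              , (if proj₂ a ≡ᵇ w then (if c (proj₁ a) then p else q) else proj₂ a)))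
       (A G))

outSplit : Digraph → (w p q t : ℕ) → (c : ℕ → Bool) → Digraph
outSplit G w p q t c = mkDigraph (removeᵇ w (V G) ++ p ∷ q ∷ t ∷ [])
  ((p , q) ∷ (p , t) ∷ (q , t) ∷ (t , q) ∷
   map (λ a → ( (if proj₁ a ≡ᵇ w then (if c (proj₂ a) then q else t) else proj₁ a)
              , (if proj₂ a ≡ᵇ w then p else proj₂ a)))
       (A G))

Balanced : ℕ → ℕ → Set
Balanced a b = a ≤ suc b × b ≤ suc a

InBalanced : Digraph → ℕ → (ℕ → Bool) → Set
InBalanced G w c =
  Balanced (countᵇ (λ a → (proj₂ a ≡ᵇ w) ∧ c (proj₁ a)) (A G))
           (countᵇ (λ a → (proj₂ a ≡ᵇ w) ∧ not (c (proj₁ a))) (A G))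

OutBalanced : Digraph → ℕ → (ℕ → Bool) → Set
OutBalanced G w c =
  Balanced (countᵇ (λ a → (proj₁ a ≡ᵇ w) ∧ c (proj₂ a)) (A G))
           (countᵇ (λ a → (proj₁ a ≡ᵇ w) ∧ not (c (proj₂ a))) (A G))

Fresh3 : Digraph → ℕ → ℕ → ℕ → Set
Fresh3 G p q t = p ∉ V G × q ∉ V G × t ∉ V G × p ≢ q × p ≢ t × q ≢ t

-- Splitting Procedure for v with parameter d.  A state is a graph together
-- with the list S of vertices of the subgraph currently replacing v.

data InStep (d : ℕ) : Digraph → List ℕ → Digraph → List ℕ → Set where
  inStep : ∀ {G S} w p q t c → w ∈ S → d < indeg G w →
           Fresh3 G p q t → InBalanced G w c →
           InStep d G S (inSplit G w p q t c) (removeᵇ w S ++ p ∷ q ∷ t ∷ [])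

data OutStep (d : ℕ) : Digraph → List ℕ → Digraph → List ℕ → Set where
  outStep : ∀ {G S} w p q t c → w ∈ S → d < outdeg G w →
            Fresh3 G p q t → OutBalanced G w c →
            OutStep d G S (outSplit G w p q t c) (removeᵇ w S ++ p ∷ q ∷ t ∷ [])

data Star (R : Digraph → List ℕ → Digraph → List ℕ → Set)
     : Digraph → List ℕ → Digraph → List ℕ → Set where
  done : ∀ {G S} → Star R G S G S
  step : ∀ {G S G′ S′ G″ S″} → R G S G′ S′ → Star R G′ S′ G″ S″ → Star R G S G″ S″

data SplittingProcedure (d : ℕ) (G : Digraph) (v : ℕ) : Digraph → List ℕ → Set where
  run : ∀ p q {G₂ S₂ G₃ S₃} →
        p ∉ V G → q ∉ V G → p ≢ q →
        Star (InStep d) (split G v p q) (p ∷ q ∷ []) G₂ S₂ →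
        All (λ w → indeg G₂ w ≤ d) S₂ →
        Star (OutStep d) G₂ S₂ G₃ S₃ →
        All (λ w → outdeg G₃ w ≤ d) S₃ →
        SplittingProcedure d G v G₃ S₃

module Submission where

-- Give a vertex of in-degree i and out-degree o the weight 1 + 3(i ∸ 3) + 3(o ∸ 3).  An in-split
-- of a vertex whose in-degree a + b ≥ 4 is divided as evenly as possible leaves p and q with
-- in-degrees a + 1 and b + 1 (so a, b ≥ 2) and out-degree 2, and t with in-degree 2 and the old
-- out-degree: the three new weights add up to one less than the old one, and out-splits are
-- symmetric.  All other vertices of the replacing subgraph keep their degrees, so its total
-- weight never exceeds the 2 + 6 max(s, r) it has right after the initial split.  Weights are
-- positive, hence the subgraph has at most 7 max(s, r) vertices, and since in the end each of
-- them has out-degree at most d, at most 7 d max(s, r) arcs.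

open import Defs
open import Data.Bool using (Bool; true; false; not; _∧_; _∨_; if_then_else_; T)
open import Data.Bool.Properties using (T-≡; T-∧; ∧-identityʳ; ∧-zeroʳ)
open import Data.Empty using (⊥-elim)
open import Data.List using (List; []; _∷_; _++_; map; length; filterᵇ)
open import Data.List.Properties using (filter-++; filter-none; length-++; map-++; map-cong-local)
open import Data.List.Membership.Propositional using (_∈_; _∉_)
open import Data.List.Membership.Propositional.Properties using (∈-++⁺ˡ; ∈-++⁺ʳ; ∈-filter⁺; ∈-filter⁻)
open import Data.List.Relation.Unary.All as All using (All; []; _∷_)
open import Data.List.Relation.Unary.All.Properties using (++⁺; map⁺)
open import Data.List.Relation.Unary.Any using (here; there)
open import Data.Nat using (ℕ; zero; suc; _+_; _*_; _∸_; _≤_; _<_; _⊔_; _≡ᵇ_; z≤n; s≤s)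
open import Data.Nat.ListAction using (sum)
open import Data.Nat.ListAction.Properties using (sum-++)
open import Data.Nat.Properties
open import Data.Nat.Tactic.RingSolver using (solve-∀)
open import Data.Product using (_×_; _,_; proj₁; proj₂; ∃; swap)
open import Data.Unit using (tt)
open import Function using (_∘_; Equivalence)
open import Relation.Binary.PropositionalEquality
open import Relation.Nullary.Decidable using (T?)

private
  variable
    X : Set
    P Q : X → Bool

≡ᵇ-refl : ∀ n → (n ≡ᵇ n) ≡ true
≡ᵇ-refl n = Equivalence.to T-≡ (≡⇒≡ᵇ n n refl)

≢⇒≡ᵇ-false : ∀ {m n} → m ≢ n → (m ≡ᵇ n) ≡ false
≢⇒≡ᵇ-false {m} {n} m≢n with m ≡ᵇ n in eq
... | false = refl
... | true  = ⊥-elim (m≢n (≡ᵇ⇒≡ m n (Equivalence.from T-≡ eq)))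

T-not-≡ᵇ⇒≢ : ∀ {m n} → T (not (m ≡ᵇ n)) → m ≢ n
T-not-≡ᵇ⇒≢ {m} t refl = subst (T ∘ not) (≡ᵇ-refl m) t

countᵇ-++ : ∀ (P : X → Bool) xs ys → countᵇ P (xs ++ ys) ≡ countᵇ P xs + countᵇ P ys
countᵇ-++ P xs ys = trans (cong length (filter-++ (T? ∘ P) xs ys)) (length-++ (filterᵇ P xs))

countᵇ-map : ∀ {Y : Set} (P : Y → Bool) (f : X → Y) xs → countᵇ P (map f xs) ≡ countᵇ (P ∘ f) xs
countᵇ-map P f []       = refl
countᵇ-map P f (x ∷ xs) with P (f x)
... | true  = cong suc (countᵇ-map P f xs)
... | false = countᵇ-map P f xs

countᵇ-congᴬ : ∀ {xs} → All (λ a → P a ≡ Q a) xs → countᵇ P xs ≡ countᵇ Q xs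
countᵇ-congᴬ [] = refl
countᵇ-congᴬ {P = P} {Q} {x ∷ xs} (Px≡Qx ∷ rest) with P x | Q x | Px≡Qx
... | true  | true  | _ = cong suc (countᵇ-congᴬ rest)
... | false | false | _ = countᵇ-congᴬ rest

countᵇ-cong : (∀ a → P a ≡ Q a) → ∀ xs → countᵇ P xs ≡ countᵇ Q xs
countᵇ-cong P≗Q xs = countᵇ-congᴬ (All.universal P≗Q xs)

countᵇ-none : ∀ {xs} → All (λ a → P a ≡ false) xs → countᵇ P xs ≡ 0
countᵇ-none {P = P} none = cong length (filter-none (T? ∘ P) (All.map (subst T) none))

countᵇ-∧-true : (∀ a → Q a ≡ true) → ∀ xs → countᵇ (λ a → P a ∧ Q a) xs ≡ countᵇ P xs
countᵇ-∧-true {Q = Q} {P = P} Q≡true =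
  countᵇ-cong (λ a → trans (cong (P a ∧_) (Q≡true a)) (∧-identityʳ (P a)))

countᵇ-∧-false : (∀ a → Q a ≡ false) → ∀ xs → countᵇ (λ a → P a ∧ Q a) xs ≡ 0
countᵇ-∧-false {Q = Q} {P = P} Q≡false xs =
  countᵇ-none (All.universal (λ a → trans (cong (P a ∧_) (Q≡false a)) (∧-zeroʳ (P a))) xs)

countᵇ-split : ∀ (P Q : X → Bool) xs →
  countᵇ P xs ≡ countᵇ (λ a → P a ∧ Q a) xs + countᵇ (λ a → P a ∧ not (Q a)) xs
countᵇ-split P Q [] = refl
countᵇ-split P Q (x ∷ xs) with P x | Q x
... | true  | true  = cong suc (countᵇ-split P Q xs)
... | true  | false = trans (cong suc (countᵇ-split P Q xs)) (sym (+-suc _ _))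
... | false | _     = countᵇ-split P Q xs

countᵇ-mono : (∀ a → T (P a) → T (Q a)) → ∀ xs → countᵇ P xs ≤ countᵇ Q xs
countᵇ-mono P⇒Q [] = z≤n
countᵇ-mono {P = P} {Q} P⇒Q (x ∷ xs) with P x in Px | Q x in Qx
... | true  | true  = s≤s (countᵇ-mono P⇒Q xs)
... | false | true  = m≤n⇒m≤1+n (countᵇ-mono P⇒Q xs)
... | false | false = countᵇ-mono P⇒Q xs
... | true  | false = ⊥-elim (subst T Qx (P⇒Q x (subst T (sym Px) tt)))

countᵇ-∨ : ∀ (P Q : X → Bool) xs → countᵇ (λ a → P a ∨ Q a) xs ≤ countᵇ P xs + countᵇ Q xs
countᵇ-∨ P Q [] = z≤n
countᵇ-∨ P Q (x ∷ xs) with P x | Q x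
... | true  | true  = s≤s (≤-trans (countᵇ-∨ P Q xs) (+-monoʳ-≤ (countᵇ P xs) (n≤1+n _)))
... | true  | false = s≤s (countᵇ-∨ P Q xs)
... | false | true  = ≤-trans (s≤s (countᵇ-∨ P Q xs)) (≤-reflexive (sym (+-suc _ _)))
... | false | false = countᵇ-∨ P Q xs

if-then-true⇒∨ : ∀ b {e} → T (if b then true else e) → T (b ∨ e)
if-then-true⇒∨ true  = λ t → t
if-then-true⇒∨ false = λ t → t

countᵇ-elemᵇ : ∀ (f : X → ℕ) S xs →
  countᵇ (λ a → elemᵇ (f a) S) xs ≤ sum (map (λ y → countᵇ (λ a → f a ≡ᵇ y) xs) S)
countᵇ-elemᵇ f []      xs = ≤-reflexive (countᵇ-none (All.universal (λ _ → refl) xs))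
countᵇ-elemᵇ f (y ∷ S) xs = begin
  countᵇ (λ a → elemᵇ (f a) (y ∷ S)) xs
    ≤⟨ countᵇ-mono (λ a → if-then-true⇒∨ (f a ≡ᵇ y)) xs ⟩
  countᵇ (λ a → (f a ≡ᵇ y) ∨ elemᵇ (f a) S) xs
    ≤⟨ countᵇ-∨ (λ a → f a ≡ᵇ y) (λ a → elemᵇ (f a) S) xs ⟩
  countᵇ (λ a → f a ≡ᵇ y) xs + countᵇ (λ a → elemᵇ (f a) S) xs
    ≤⟨ +-monoʳ-≤ _ (countᵇ-elemᵇ f S xs) ⟩
  countᵇ (λ a → f a ≡ᵇ y) xs + sum (map (λ y → countᵇ (λ a → f a ≡ᵇ y) xs) S) ∎
  where open ≤-Reasoning

length≤sum-map : ∀ {f : ℕ → ℕ} → (∀ x → 1 ≤ f x) → ∀ xs → length xs ≤ sum (map f xs)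
length≤sum-map pos []       = z≤n
length≤sum-map pos (x ∷ xs) = +-mono-≤ (pos x) (length≤sum-map pos xs)

sum-map≤*length : ∀ {f : ℕ → ℕ} {d xs} → All (λ x → f x ≤ d) xs → sum (map f xs) ≤ d * length xs
sum-map≤*length {d = d} []                       = ≤-reflexive (sym (*-zeroʳ d))
sum-map≤*length {d = d} {_ ∷ xs} (fx≤d ∷ rest) =
  ≤-trans (+-mono-≤ fx≤d (sum-map≤*length rest)) (≤-reflexive (sym (*-suc d (length xs))))

sum-removeᵇ-≤ : ∀ (f : ℕ → ℕ) w xs → sum (map f (removeᵇ w xs)) ≤ sum (map f xs)
sum-removeᵇ-≤ f w []       = z≤n
sum-removeᵇ-≤ f w (y ∷ ys) with y ≡ᵇ w
... | true  = ≤-trans (sum-removeᵇ-≤ f w ys) (m≤n+m _ (f y))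
... | false = +-monoʳ-≤ (f y) (sum-removeᵇ-≤ f w ys)

sum-removeᵇ : ∀ (f : ℕ → ℕ) {w xs} → w ∈ xs → sum (map f (removeᵇ w xs)) + f w ≤ sum (map f xs)
sum-removeᵇ f {w} {y ∷ ys} w∈ with y ≡ᵇ w in y≡ᵇw | w∈
... | true  | _ rewrite ≡ᵇ⇒≡ y w (Equivalence.from T-≡ y≡ᵇw) =
  ≤-trans (≤-reflexive (+-comm _ (f w))) (+-monoʳ-≤ (f w) (sum-removeᵇ-≤ f w ys))
... | false | here refl = ⊥-elim (subst T (trans (sym (≡ᵇ-refl w)) y≡ᵇw) tt)
... | false | there w∈ys =
  ≤-trans (≤-reflexive (+-assoc (f y) _ (f w))) (+-monoʳ-≤ (f y) (sum-removeᵇ f w∈ys))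

sum-replace-≤ : ∀ (f g : ℕ → ℕ) {w xs} ys → w ∈ xs →
  All (λ x → g x ≡ f x) (removeᵇ w xs) → sum (map g ys) ≤ f w →
  sum (map g (removeᵇ w xs ++ ys)) ≤ sum (map f xs)
sum-replace-≤ f g {w} {xs} ys w∈xs agree ys≤fw = begin
  sum (map g (removeᵇ w xs ++ ys))            ≡⟨ cong sum (map-++ g (removeᵇ w xs) ys) ⟩
  sum (map g (removeᵇ w xs) ++ map g ys)     ≡⟨ sum-++ (map g (removeᵇ w xs)) (map g ys) ⟩
  sum (map g (removeᵇ w xs)) + sum (map g ys) ≡⟨ cong (λ s → sum s + _) (map-cong-local agree) ⟩
  sum (map f (removeᵇ w xs)) + sum (map g ys) ≤⟨ +-monoʳ-≤ _ ys≤fw ⟩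
  sum (map f (removeᵇ w xs)) + f w           ≤⟨ sum-removeᵇ f w∈xs ⟩
  sum (map f xs)                             ∎
  where open ≤-Reasoning

-- Arithmetic of the cost

cost : ℕ → ℕ → ℕ
cost i o = 1 + 3 * (i ∸ 3) + 3 * (o ∸ 3)

balanced⇒2≤ : ∀ {a b} → Balanced a b → 4 ≤ a + b → 2 ≤ a
balanced⇒2≤ {zero}  (_ , b≤1) 4≤b with ≤-trans 4≤b b≤1
... | s≤s ()
balanced⇒2≤ {suc zero} (_ , b≤2) 4≤1+b with ≤-trans 4≤1+b (s≤s b≤2)
... | s≤s (s≤s (s≤s ()))
balanced⇒2≤ {suc (suc a)} _ _ = s≤s (s≤s z≤n)

excess-halves : ∀ {a b} → Balanced a b → 4 ≤ a + b → suc ((suc a ∸ 3) + (suc b ∸ 3)) ≡ a + b ∸ 3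
excess-halves {a} {b} bal 4≤a+b
  with a′ , refl ← m≤n⇒∃[o]m+o≡n (balanced⇒2≤ bal 4≤a+b)
     | b′ , refl ← m≤n⇒∃[o]m+o≡n (balanced⇒2≤ (swap bal) (subst (4 ≤_) (+-comm a b) 4≤a+b))
  = sym (trans (cong (_∸ 1) (+-suc a′ (suc b′))) (+-suc a′ b′))

cost-in-split : ∀ {a b} → Balanced a b → 4 ≤ a + b → ∀ k →
  cost (suc a) 2 + (cost (suc b) 2 + (cost 2 k + 0)) ≤ cost (a + b) k
cost-in-split {a} {b} bal 4≤a+b k = ≤-trans (n≤1+n _) (≤-reflexive (trans
  (regroup (suc a ∸ 3) (suc b ∸ 3) (k ∸ 3))
  (cong (λ e → 1 + 3 * e + 3 * (k ∸ 3)) (excess-halves bal 4≤a+b))))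
  where
  -- the left side is the three costs as they normalise, with x, y, z for the three excesses
  regroup : ∀ x y z → suc ((1 + 3 * x + 0) + ((1 + 3 * y + 0) + ((1 + 0 + 3 * z) + 0)))
                    ≡ 1 + 3 * suc (x + y) + 3 * z
  regroup = solve-∀

cost-out-split : ∀ {a b} → Balanced a b → 4 ≤ a + b → ∀ k →
  cost k 2 + (cost 2 (suc a) + (cost 2 (suc b) + 0)) ≤ cost k (a + b)
cost-out-split {a} {b} bal 4≤a+b k = ≤-trans (n≤1+n _) (≤-reflexive (trans
  (regroup (suc a ∸ 3) (suc b ∸ 3) (k ∸ 3))
  (cong (λ e → 1 + 3 * (k ∸ 3) + 3 * e) (excess-halves bal 4≤a+b))))
  where
  regroup : ∀ x y z → suc ((1 + 3 * z + 0) + ((1 + 0 + 3 * x) + ((1 + 0 + 3 * y) + 0)))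
                    ≡ 1 + 3 * z + 3 * suc (x + y)
  regroup = solve-∀

cost-split : ∀ {s r} → 2 ≤ s ⊔ r → cost s 1 + (cost 1 r + 0) ≤ 7 * (s ⊔ r)
cost-split {s} {r} 2≤m = begin
  cost s 1 + (cost 1 r + 0)
    ≤⟨ +-mono-≤ (s≤s (+-monoˡ-≤ 0 (excess≤ (m≤m⊔n s r))))
                (+-monoˡ-≤ 0 (s≤s (excess≤ (m≤n⊔m s r)))) ⟩
  suc (3 * m + 0) + (suc (3 * m) + 0) ≡⟨ regroup m ⟩
  2 + 6 * m                            ≤⟨ +-monoˡ-≤ (6 * m) 2≤m ⟩
  7 * m                                ∎
  where
  open ≤-Reasoning
  m = s ⊔ r
  excess≤ : ∀ {i} → i ≤ m → 3 * (i ∸ 3) ≤ 3 * m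
  excess≤ i≤m = *-monoʳ-≤ 3 (≤-trans (m∸n≤m _ 3) i≤m)
  regroup : ∀ x → suc (3 * x + 0) + (suc (3 * x) + 0) ≡ 2 + 6 * x
  regroup = solve-∀

-- The potential

ArcsClosed : Digraph → Set
ArcsClosed G = All (λ a → proj₁ a ∈ V G × proj₂ a ∈ V G) (A G)

Closed : Digraph → List ℕ → Set
Closed G S = ArcsClosed G × All (_∈ V G) S

weight : Digraph → ℕ → ℕ
weight G x = cost (indeg G x) (outdeg G x)

potential : Digraph → List ℕ → ℕ
potential G S = sum (map (weight G) S)

Descends : (Digraph → List ℕ → Digraph → List ℕ → Set) → Set
Descends R = ∀ {G S G′ S′} → R G S G′ S′ → Closed G S → Closed G′ S′ × potential G′ S′ ≤ potential G S

star-descends : ∀ {R} → Descends R → Descends (Star R)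
star-descends R↓ done        closed = closed , ≤-refl
star-descends R↓ (step r rs) closed =
  let closed′ , r≤ = R↓ r closed
      closed″ , rs≤ = star-descends R↓ rs closed′
  in  closed″ , ≤-trans rs≤ r≤

redirect : (ℕ × ℕ → ℕ) → ℕ → (ℕ × ℕ → ℕ) → ℕ × ℕ → ℕ
redirect end w new a = if end a ≡ᵇ w then new a else end a

redirect-≡ᵇ-old : ∀ (end new : ℕ × ℕ → ℕ) {w x} → x ≢ w → (∀ a → new a ≢ x) →
  ∀ a → (redirect end w new a ≡ᵇ x) ≡ (end a ≡ᵇ x)
redirect-≡ᵇ-old end new {w} {x} x≢w new≢x a with end a ≡ᵇ w in end≡ᵇw
... | false = refl
... | true  = trans (≢⇒≡ᵇ-false (new≢x a))
                    (sym (≢⇒≡ᵇ-false (λ end≡x → x≢w (trans (sym end≡x) end≡w))))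
  where end≡w = ≡ᵇ⇒≡ (end a) w (Equivalence.from T-≡ end≡ᵇw)

redirect-≡ᵇ-fresh : ∀ (end new : ℕ × ℕ → ℕ) {w n} a → end a ≢ n →
  (redirect end w new a ≡ᵇ n) ≡ (end a ≡ᵇ w) ∧ (new a ≡ᵇ n)
redirect-≡ᵇ-fresh end new {w} a end≢n with end a ≡ᵇ w
... | true  = refl
... | false = ≢⇒≡ᵇ-false end≢n

record Admissible (G : Digraph) (N : List ℕ) (gadget : List (ℕ × ℕ))
                  (newTail newHead : ℕ × ℕ → ℕ) : Set where
  field
    fresh     : All (_∉ V G) N
    gadget⊆N  : All (λ a → proj₁ a ∈ N × proj₂ a ∈ N) gadget
    newTail∈N : ∀ a → newTail a ∈ N
    newHead∈N : ∀ a → newHead a ∈ N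

-- split, inSplit and outSplit are, up to definitional equality, instances of replaced.
module Replacement (G : Digraph) (w : ℕ) (N : List ℕ) (gadget : List (ℕ × ℕ))
                   (newTail newHead : ℕ × ℕ → ℕ) where

  redirectArc : ℕ × ℕ → ℕ × ℕ
  redirectArc a = redirect proj₁ w newTail a , redirect proj₂ w newHead a

  replaced : Digraph
  replaced = mkDigraph (removeᵇ w (V G) ++ N) (gadget ++ map redirectArc (A G))

  indeg-fresh : ArcsClosed G → ∀ {n} → n ∉ V G →
    indeg replaced n ≡ countᵇ (λ a → proj₂ a ≡ᵇ n) gadget
                     + countᵇ (λ a → (proj₂ a ≡ᵇ w) ∧ (newHead a ≡ᵇ n)) (A G)
  indeg-fresh closed n∉V = trans (countᵇ-++ _ gadget _) (cong (_ +_)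
    (trans (countᵇ-map _ redirectArc (A G)) (countᵇ-congᴬ (All.map
      (λ (_ , h∈V) → redirect-≡ᵇ-fresh proj₂ newHead _ (λ { refl → n∉V h∈V })) closed))))

  outdeg-fresh : ArcsClosed G → ∀ {n} → n ∉ V G →
    outdeg replaced n ≡ countᵇ (λ a → proj₁ a ≡ᵇ n) gadget
                      + countᵇ (λ a → (proj₁ a ≡ᵇ w) ∧ (newTail a ≡ᵇ n)) (A G)
  outdeg-fresh closed n∉V = trans (countᵇ-++ _ gadget _) (cong (_ +_)
    (trans (countᵇ-map _ redirectArc (A G)) (countᵇ-congᴬ (All.map
      (λ (t∈V , _) → redirect-≡ᵇ-fresh proj₁ newTail _ (λ { refl → n∉V t∈V })) closed))))

  module _ (admissible : Admissible G N gadget newTail newHead) where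
    open Admissible admissible

    new≢old : ∀ {y x} → y ∈ N → x ∈ V G → y ≢ x
    new≢old y∈N x∈V refl = All.lookup fresh y∈N x∈V

    indeg-old : ∀ {x} → x ∈ V G → x ≢ w → indeg replaced x ≡ indeg G x
    indeg-old x∈V x≢w = trans (countᵇ-++ _ gadget _) (cong₂ _+_
      (countᵇ-none (All.map (λ (_ , h∈N) → ≢⇒≡ᵇ-false (new≢old h∈N x∈V)) gadget⊆N))
      (trans (countᵇ-map _ redirectArc (A G))
             (countᵇ-cong (redirect-≡ᵇ-old proj₂ newHead x≢w (λ a → new≢old (newHead∈N a) x∈V)) (A G))))

    outdeg-old : ∀ {x} → x ∈ V G → x ≢ w → outdeg replaced x ≡ outdeg G x
    outdeg-old x∈V x≢w = trans (countᵇ-++ _ gadget _) (cong₂ _+_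
      (countᵇ-none (All.map (λ (t∈N , _) → ≢⇒≡ᵇ-false (new≢old t∈N x∈V)) gadget⊆N))
      (trans (countᵇ-map _ redirectArc (A G))
             (countᵇ-cong (redirect-≡ᵇ-old proj₁ newTail x≢w (λ a → new≢old (newTail∈N a) x∈V)) (A G))))

    N⊆V : All (_∈ V replaced) N
    N⊆V = All.tabulate (∈-++⁺ʳ (removeᵇ w (V G)))

    survivor∈V : ∀ {x} → x ∈ V G → T (not (x ≡ᵇ w)) → x ∈ V replaced
    survivor∈V x∈V x≠ᵇw = ∈-++⁺ˡ (∈-filter⁺ (T? ∘ λ y → not (y ≡ᵇ w)) x∈V x≠ᵇw)

    redirect∈V : ∀ end new a → end a ∈ V G → new a ∈ N → redirect end w new a ∈ V replaced
    redirect∈V end new a end∈V new∈N with end a ≡ᵇ w in end≡ᵇw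
    ... | true  = ∈-++⁺ʳ (removeᵇ w (V G)) new∈N
    ... | false = survivor∈V end∈V (subst (T ∘ not) (sym end≡ᵇw) tt)

    replaced-closed : ArcsClosed G → ArcsClosed replaced
    replaced-closed closed = ++⁺
      (All.map (λ (t∈N , h∈N) → ∈-++⁺ʳ (removeᵇ w (V G)) t∈N , ∈-++⁺ʳ (removeᵇ w (V G)) h∈N) gadget⊆N)
      (map⁺ (All.map (λ {a} (t∈V , h∈V) → redirect∈V proj₁ newTail a t∈V (newTail∈N a)
                                         , redirect∈V proj₂ newHead a h∈V (newHead∈N a)) closed))

    weight-old : ∀ {x} → x ∈ V G → x ≢ w → weight replaced x ≡ weight G x
    weight-old x∈V x≢w = cong₂ cost (indeg-old x∈V x≢w) (outdeg-old x∈V x≢w)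

    replaced-descends : ∀ {S} → Closed G S → w ∈ S → sum (map (weight replaced) N) ≤ weight G w →
      Closed replaced (removeᵇ w S ++ N) × potential replaced (removeᵇ w S ++ N) ≤ potential G S
    replaced-descends {S} (closed , S⊆V) w∈S N≤w =
        ( replaced-closed closed
        , ++⁺ (All.tabulate λ x∈ → survivor∈V (inV x∈) (proj₂ (survivor x∈))) N⊆V)
      , sum-replace-≤ (weight G) (weight replaced) N w∈S
          (All.tabulate λ x∈ → weight-old (inV x∈) (T-not-≡ᵇ⇒≢ (proj₂ (survivor x∈)))) N≤w
      where
      survivor : ∀ {x} → x ∈ removeᵇ w S → x ∈ S × T (not (x ≡ᵇ w))
      survivor = ∈-filter⁻ (T? ∘ λ y → not (y ≡ᵇ w))
      inV : ∀ {x} → x ∈ removeᵇ w S → x ∈ V G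
      inV = All.lookup S⊆V ∘ proj₁ ∘ survivor

if-≡ᵇ-then : ∀ b {x y} → x ≢ y → ((if b then x else y) ≡ᵇ x) ≡ b
if-≡ᵇ-then true  {x} _ = ≡ᵇ-refl x
if-≡ᵇ-then false x≢y   = ≢⇒≡ᵇ-false (x≢y ∘ sym)

if-≡ᵇ-else : ∀ b {x y} → x ≢ y → ((if b then x else y) ≡ᵇ y) ≡ not b
if-≡ᵇ-else true  x≢y       = ≢⇒≡ᵇ-false x≢y
if-≡ᵇ-else false {y = y} _ = ≡ᵇ-refl y

if-≡ᵇ-neither : ∀ b {x y n} → x ≢ n → y ≢ n → ((if b then x else y) ≡ᵇ n) ≡ false
if-≡ᵇ-neither true  x≢n _   = ≢⇒≡ᵇ-false x≢n
if-≡ᵇ-neither false _   y≢n = ≢⇒≡ᵇ-false y≢n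

if-∈ : ∀ b {x y} {xs : List ℕ} → x ∈ xs → y ∈ xs → (if b then x else y) ∈ xs
if-∈ true  x∈ _ = x∈
if-∈ false _ y∈ = y∈

module SplitDegrees (G : Digraph) (v p q : ℕ) (closed : ArcsClosed G)
                    (p∉V : p ∉ V G) (q∉V : q ∉ V G) (p≢q : p ≢ q) where

  gadget : List (ℕ × ℕ)
  gadget = (p , q) ∷ []

  open Replacement G v (p ∷ q ∷ []) gadget (λ _ → q) (λ _ → p) public

  admissible : Admissible G (p ∷ q ∷ []) gadget (λ _ → q) (λ _ → p)
  admissible = record
    { fresh     = p∉V ∷ q∉V ∷ []
    ; gadget⊆N  = (here refl , there (here refl)) ∷ []
    ; newTail∈N = λ _ → there (here refl)
    ; newHead∈N = λ _ → here refl
    }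

  q≢ᵇp : (q ≡ᵇ p) ≡ false
  q≢ᵇp = ≢⇒≡ᵇ-false (p≢q ∘ sym)

  indeg-p : indeg (split G v p q) p ≡ indeg G v
  indeg-p = trans (indeg-fresh closed p∉V) (cong₂ _+_
    (countᵇ-none {P = λ a → proj₂ a ≡ᵇ p} {gadget} (q≢ᵇp ∷ []))
    (countᵇ-∧-true (λ _ → ≡ᵇ-refl p) (A G)))

  outdeg-p : outdeg (split G v p q) p ≡ 1
  outdeg-p = trans (outdeg-fresh closed p∉V) (cong₂ _+_ tails
    (countᵇ-∧-false (λ _ → q≢ᵇp) (A G)))
    where tails : countᵇ (λ a → proj₁ a ≡ᵇ p) gadget ≡ 1
          tails rewrite ≡ᵇ-refl p = refl

  indeg-q : indeg (split G v p q) q ≡ 1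
  indeg-q = trans (indeg-fresh closed q∉V) (cong₂ _+_ heads
    (countᵇ-∧-false (λ _ → ≢⇒≡ᵇ-false p≢q) (A G)))
    where heads : countᵇ (λ a → proj₂ a ≡ᵇ q) gadget ≡ 1
          heads rewrite ≡ᵇ-refl q = refl

  outdeg-q : outdeg (split G v p q) q ≡ outdeg G v
  outdeg-q = trans (outdeg-fresh closed q∉V) (cong₂ _+_
    (countᵇ-none {P = λ a → proj₁ a ≡ᵇ q} {gadget} (≢⇒≡ᵇ-false p≢q ∷ []))
    (countᵇ-∧-true (λ _ → ≡ᵇ-refl q) (A G)))

  potential-split : 2 ≤ indeg G v ⊔ outdeg G v →
    potential (split G v p q) (p ∷ q ∷ []) ≤ 7 * (indeg G v ⊔ outdeg G v)
  potential-split 2≤m = begin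
    potential (split G v p q) (p ∷ q ∷ [])
      ≡⟨ cong₂ _+_ (cong₂ cost indeg-p outdeg-p) (cong (_+ 0) (cong₂ cost indeg-q outdeg-q)) ⟩
    cost (indeg G v) 1 + (cost 1 (outdeg G v) + 0)
      ≤⟨ cost-split {indeg G v} {outdeg G v} 2≤m ⟩
    7 * (indeg G v ⊔ outdeg G v) ∎
    where open ≤-Reasoning

module InSplitDegrees (G : Digraph) (w p q t : ℕ) (c : ℕ → Bool) (closed : ArcsClosed G)
                      (p∉V : p ∉ V G) (q∉V : q ∉ V G) (t∉V : t ∉ V G)
                      (p≢q : p ≢ q) (p≢t : p ≢ t) (q≢t : q ≢ t) where

  gadget : List (ℕ × ℕ)
  gadget = (p , q) ∷ (q , p) ∷ (p , t) ∷ (q , t) ∷ []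

  newHead : ℕ × ℕ → ℕ
  newHead a = if c (proj₁ a) then p else q

  open Replacement G w (p ∷ q ∷ t ∷ []) gadget (λ _ → t) newHead public

  admissible : Admissible G (p ∷ q ∷ t ∷ []) gadget (λ _ → t) newHead
  admissible = record
    { fresh     = p∉V ∷ q∉V ∷ t∉V ∷ []
    ; gadget⊆N  = (p∈ , q∈) ∷ (q∈ , p∈) ∷ (p∈ , t∈) ∷ (q∈ , t∈) ∷ []
    ; newTail∈N = λ _ → t∈
    ; newHead∈N = λ a → if-∈ (c (proj₁ a)) p∈ q∈
    }
    where
    p∈ = here refl
    q∈ = there (here refl)
    t∈ = there (there (here refl))

  G′ : Digraph
  G′ = inSplit G w p q t c

  indeg-p : indeg G′ p ≡ suc (countᵇ (λ a → (proj₂ a ≡ᵇ w) ∧ c (proj₁ a)) (A G))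
  indeg-p = trans (indeg-fresh closed p∉V) (cong₂ _+_ heads
    (countᵇ-cong (λ a → cong ((proj₂ a ≡ᵇ w) ∧_) (if-≡ᵇ-then (c (proj₁ a)) p≢q)) (A G)))
    where heads : countᵇ (λ a → proj₂ a ≡ᵇ p) gadget ≡ 1
          -- each rewrite unblocks the filter at one more arc of the gadget, hence the repetitions
          heads rewrite ≢⇒≡ᵇ-false (p≢q ∘ sym) | ≡ᵇ-refl p | ≢⇒≡ᵇ-false (p≢t ∘ sym)
                      | ≢⇒≡ᵇ-false (p≢t ∘ sym) = refl

  indeg-q : indeg G′ q ≡ suc (countᵇ (λ a → (proj₂ a ≡ᵇ w) ∧ not (c (proj₁ a))) (A G))
  indeg-q = trans (indeg-fresh closed q∉V) (cong₂ _+_ heads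
    (countᵇ-cong (λ a → cong ((proj₂ a ≡ᵇ w) ∧_) (if-≡ᵇ-else (c (proj₁ a)) p≢q)) (A G)))
    where heads : countᵇ (λ a → proj₂ a ≡ᵇ q) gadget ≡ 1
          heads rewrite ≡ᵇ-refl q | ≢⇒≡ᵇ-false p≢q | ≢⇒≡ᵇ-false (q≢t ∘ sym)
                      | ≢⇒≡ᵇ-false (q≢t ∘ sym) = refl

  indeg-t : indeg G′ t ≡ 2
  indeg-t = trans (indeg-fresh closed t∉V) (cong₂ _+_ heads
    (countᵇ-∧-false (λ a → if-≡ᵇ-neither (c (proj₁ a)) p≢t q≢t) (A G)))
    where heads : countᵇ (λ a → proj₂ a ≡ᵇ t) gadget ≡ 2
          heads rewrite ≢⇒≡ᵇ-false q≢t | ≢⇒≡ᵇ-false p≢t | ≡ᵇ-refl t | ≡ᵇ-refl t = refl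

  outdeg-p : outdeg G′ p ≡ 2
  outdeg-p = trans (outdeg-fresh closed p∉V) (cong₂ _+_ tails
    (countᵇ-∧-false (λ _ → ≢⇒≡ᵇ-false (p≢t ∘ sym)) (A G)))
    where tails : countᵇ (λ a → proj₁ a ≡ᵇ p) gadget ≡ 2
          tails rewrite ≡ᵇ-refl p | ≢⇒≡ᵇ-false (p≢q ∘ sym) | ≡ᵇ-refl p
                      | ≢⇒≡ᵇ-false (p≢q ∘ sym) = refl

  outdeg-q : outdeg G′ q ≡ 2
  outdeg-q = trans (outdeg-fresh closed q∉V) (cong₂ _+_ tails
    (countᵇ-∧-false (λ _ → ≢⇒≡ᵇ-false (q≢t ∘ sym)) (A G)))
    where tails : countᵇ (λ a → proj₁ a ≡ᵇ q) gadget ≡ 2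
          tails rewrite ≢⇒≡ᵇ-false p≢q | ≡ᵇ-refl q | ≢⇒≡ᵇ-false p≢q | ≡ᵇ-refl q = refl

  outdeg-t : outdeg G′ t ≡ outdeg G w
  outdeg-t = trans (outdeg-fresh closed t∉V) (cong₂ _+_
    (countᵇ-none {P = λ a → proj₁ a ≡ᵇ t} {gadget} (p≢ᵇt ∷ q≢ᵇt ∷ p≢ᵇt ∷ q≢ᵇt ∷ []))
    (countᵇ-∧-true (λ _ → ≡ᵇ-refl t) (A G)))
    where p≢ᵇt = ≢⇒≡ᵇ-false p≢t
          q≢ᵇt = ≢⇒≡ᵇ-false q≢t

  gadget-weight : InBalanced G w c → 4 ≤ indeg G w →
    sum (map (weight G′) (p ∷ q ∷ t ∷ [])) ≤ weight G w
  gadget-weight balanced 4≤indeg = begin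
    weight G′ p + (weight G′ q + (weight G′ t + 0))
      ≡⟨ cong₂ _+_ (cong₂ cost indeg-p outdeg-p)
           (cong₂ _+_ (cong₂ cost indeg-q outdeg-q) (cong (_+ 0) (cong₂ cost indeg-t outdeg-t))) ⟩
    cost (suc toP) 2 + (cost (suc toQ) 2 + (cost 2 (outdeg G w) + 0))
      ≤⟨ cost-in-split balanced (subst (4 ≤_) indeg-w 4≤indeg) (outdeg G w) ⟩
    cost (toP + toQ) (outdeg G w)
      ≡⟨ cong (λ i → cost i (outdeg G w)) (sym indeg-w) ⟩
    weight G w ∎
    where
    open ≤-Reasoning
    toP = countᵇ (λ a → (proj₂ a ≡ᵇ w) ∧ c (proj₁ a)) (A G)
    toQ = countᵇ (λ a → (proj₂ a ≡ᵇ w) ∧ not (c (proj₁ a))) (A G)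
    indeg-w : indeg G w ≡ toP + toQ
    indeg-w = countᵇ-split (λ a → proj₂ a ≡ᵇ w) (c ∘ proj₁) (A G)

module OutSplitDegrees (G : Digraph) (w p q t : ℕ) (c : ℕ → Bool) (closed : ArcsClosed G)
                       (p∉V : p ∉ V G) (q∉V : q ∉ V G) (t∉V : t ∉ V G)
                       (p≢q : p ≢ q) (p≢t : p ≢ t) (q≢t : q ≢ t) where

  gadget : List (ℕ × ℕ)
  gadget = (p , q) ∷ (p , t) ∷ (q , t) ∷ (t , q) ∷ []

  newTail : ℕ × ℕ → ℕ
  newTail a = if c (proj₂ a) then q else t

  open Replacement G w (p ∷ q ∷ t ∷ []) gadget newTail (λ _ → p) public

  admissible : Admissible G (p ∷ q ∷ t ∷ []) gadget newTail (λ _ → p)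
  admissible = record
    { fresh     = p∉V ∷ q∉V ∷ t∉V ∷ []
    ; gadget⊆N  = (p∈ , q∈) ∷ (p∈ , t∈) ∷ (q∈ , t∈) ∷ (t∈ , q∈) ∷ []
    ; newTail∈N = λ a → if-∈ (c (proj₂ a)) q∈ t∈
    ; newHead∈N = λ _ → p∈
    }
    where
    p∈ = here refl
    q∈ = there (here refl)
    t∈ = there (there (here refl))

  G′ : Digraph
  G′ = outSplit G w p q t c

  indeg-p : indeg G′ p ≡ indeg G w
  indeg-p = trans (indeg-fresh closed p∉V) (cong₂ _+_
    (countᵇ-none {P = λ a → proj₂ a ≡ᵇ p} {gadget} (q≢ᵇp ∷ t≢ᵇp ∷ t≢ᵇp ∷ q≢ᵇp ∷ []))
    (countᵇ-∧-true (λ _ → ≡ᵇ-refl p) (A G)))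
    where q≢ᵇp = ≢⇒≡ᵇ-false (p≢q ∘ sym)
          t≢ᵇp = ≢⇒≡ᵇ-false (p≢t ∘ sym)

  indeg-q : indeg G′ q ≡ 2
  indeg-q = trans (indeg-fresh closed q∉V) (cong₂ _+_ heads
    (countᵇ-∧-false (λ _ → ≢⇒≡ᵇ-false p≢q) (A G)))
    where heads : countᵇ (λ a → proj₂ a ≡ᵇ q) gadget ≡ 2
          heads rewrite ≡ᵇ-refl q | ≢⇒≡ᵇ-false (q≢t ∘ sym) | ≢⇒≡ᵇ-false (q≢t ∘ sym)
                      | ≡ᵇ-refl q = refl

  indeg-t : indeg G′ t ≡ 2
  indeg-t = trans (indeg-fresh closed t∉V) (cong₂ _+_ heads
    (countᵇ-∧-false (λ _ → ≢⇒≡ᵇ-false p≢t) (A G)))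
    where heads : countᵇ (λ a → proj₂ a ≡ᵇ t) gadget ≡ 2
          heads rewrite ≢⇒≡ᵇ-false q≢t | ≡ᵇ-refl t | ≡ᵇ-refl t | ≢⇒≡ᵇ-false q≢t = refl

  outdeg-p : outdeg G′ p ≡ 2
  outdeg-p = trans (outdeg-fresh closed p∉V) (cong₂ _+_ tails
    (countᵇ-∧-false (λ a → if-≡ᵇ-neither (c (proj₂ a)) (p≢q ∘ sym) (p≢t ∘ sym)) (A G)))
    where tails : countᵇ (λ a → proj₁ a ≡ᵇ p) gadget ≡ 2
          tails rewrite ≡ᵇ-refl p | ≡ᵇ-refl p | ≢⇒≡ᵇ-false (p≢q ∘ sym)
                      | ≢⇒≡ᵇ-false (p≢t ∘ sym) = refl

  outdeg-q : outdeg G′ q ≡ suc (countᵇ (λ a → (proj₁ a ≡ᵇ w) ∧ c (proj₂ a)) (A G))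
  outdeg-q = trans (outdeg-fresh closed q∉V) (cong₂ _+_ tails
    (countᵇ-cong (λ a → cong ((proj₁ a ≡ᵇ w) ∧_) (if-≡ᵇ-then (c (proj₂ a)) q≢t)) (A G)))
    where tails : countᵇ (λ a → proj₁ a ≡ᵇ q) gadget ≡ 1
          tails rewrite ≢⇒≡ᵇ-false p≢q | ≢⇒≡ᵇ-false p≢q | ≡ᵇ-refl q
                      | ≢⇒≡ᵇ-false (q≢t ∘ sym) = refl

  outdeg-t : outdeg G′ t ≡ suc (countᵇ (λ a → (proj₁ a ≡ᵇ w) ∧ not (c (proj₂ a))) (A G))
  outdeg-t = trans (outdeg-fresh closed t∉V) (cong₂ _+_ tails
    (countᵇ-cong (λ a → cong ((proj₁ a ≡ᵇ w) ∧_) (if-≡ᵇ-else (c (proj₂ a)) q≢t)) (A G)))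
    where tails : countᵇ (λ a → proj₁ a ≡ᵇ t) gadget ≡ 1
          tails rewrite ≢⇒≡ᵇ-false p≢t | ≢⇒≡ᵇ-false p≢t | ≢⇒≡ᵇ-false q≢t | ≡ᵇ-refl t = refl

  gadget-weight : OutBalanced G w c → 4 ≤ outdeg G w →
    sum (map (weight G′) (p ∷ q ∷ t ∷ [])) ≤ weight G w
  gadget-weight balanced 4≤outdeg = begin
    weight G′ p + (weight G′ q + (weight G′ t + 0))
      ≡⟨ cong₂ _+_ (cong₂ cost indeg-p outdeg-p)
           (cong₂ _+_ (cong₂ cost indeg-q outdeg-q) (cong (_+ 0) (cong₂ cost indeg-t outdeg-t))) ⟩
    cost (indeg G w) 2 + (cost 2 (suc fromQ) + (cost 2 (suc fromT) + 0))
      ≤⟨ cost-out-split balanced (subst (4 ≤_) outdeg-w 4≤outdeg) (indeg G w) ⟩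
    cost (indeg G w) (fromQ + fromT)
      ≡⟨ cong (cost (indeg G w)) (sym outdeg-w) ⟩
    weight G w ∎
    where
    open ≤-Reasoning
    fromQ = countᵇ (λ a → (proj₁ a ≡ᵇ w) ∧ c (proj₂ a)) (A G)
    fromT = countᵇ (λ a → (proj₁ a ≡ᵇ w) ∧ not (c (proj₂ a))) (A G)
    outdeg-w : outdeg G w ≡ fromQ + fromT
    outdeg-w = countᵇ-split (λ a → proj₁ a ≡ᵇ w) (c ∘ proj₂) (A G)

-- The Splitting Procedure

inStep-descends : ∀ {d} → 3 ≤ d → Descends (InStep d)
inStep-descends 3≤d
  (inStep {G} w p q t c w∈S d<indeg (p∉V , q∉V , t∉V , p≢q , p≢t , q≢t) balanced) closed =
  replaced-descends admissible closed w∈S (gadget-weight balanced (≤-trans (s≤s 3≤d) d<indeg))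
  where open InSplitDegrees G w p q t c (proj₁ closed) p∉V q∉V t∉V p≢q p≢t q≢t

outStep-descends : ∀ {d} → 3 ≤ d → Descends (OutStep d)
outStep-descends 3≤d
  (outStep {G} w p q t c w∈S d<outdeg (p∉V , q∉V , t∉V , p≢q , p≢t , q≢t) balanced) closed =
  replaced-descends admissible closed w∈S (gadget-weight balanced (≤-trans (s≤s 3≤d) d<outdeg))
  where open OutSplitDegrees G w p q t c (proj₁ closed) p∉V q∉V t∉V p≢q p≢t q≢t

procedure-potential : ∀ {d G v G′ S} → 3 ≤ d → WellFormed G → 2 ≤ indeg G v ⊔ outdeg G v →
  SplittingProcedure d G v G′ S → potential G′ S ≤ 7 * (indeg G v ⊔ outdeg G v)
procedure-potential {G = G} {v} 3≤d wf 2≤m (run p q p∉V q∉V p≢q inSteps _ outSteps _) =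
  ≤-trans (proj₂ afterOut) (≤-trans (proj₂ afterIn) (potential-split 2≤m))
  where
  closedG : ArcsClosed G
  closedG = All.zip (WellFormed.tailsInV wf , WellFormed.headsInV wf)
  open SplitDegrees G v p q closedG p∉V q∉V p≢q
  afterIn  = star-descends (inStep-descends 3≤d) inSteps
               (replaced-closed admissible closedG , N⊆V admissible)
  afterOut = star-descends (outStep-descends 3≤d) outSteps (proj₁ afterIn)

arcsWithin≤sum-outdeg : ∀ G S → arcsWithin G S ≤ sum (map (outdeg G) S)
arcsWithin≤sum-outdeg G S =
  ≤-trans (countᵇ-mono (λ a → proj₁ ∘ Equivalence.to T-∧) (A G)) (countᵇ-elemᵇ proj₁ S (A G))

procedure-outdeg≤ : ∀ {d G v G′ S} → SplittingProcedure d G v G′ S → All (λ x → outdeg G′ x ≤ d) S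
procedure-outdeg≤ (run _ _ _ _ _ _ _ _ outdeg≤d) = outdeg≤d

proposition5p2 : (d : ℕ) → 4 ≤ d →
    ∃ λ (C : ℕ) → (G : Digraph) → WellFormed G → (v : ℕ) → v ∈ V G →
      d < indeg G v ⊔ outdeg G v →
      (G′ : Digraph) → (S : _) → SplittingProcedure d G v G′ S →
      (length S ≤ C * (indeg G v ⊔ outdeg G v)) ×
      (arcsWithin G′ S ≤ C * (indeg G v ⊔ outdeg G v))
proposition5p2 d 4≤d = 7 * d , λ G wf v _ d<m G′ S procedure →
  let m = indeg G v ⊔ outdeg G v
      |S|≤7m : length S ≤ 7 * m
      |S|≤7m = ≤-trans (length≤sum-map (λ _ → s≤s z≤n) S)
                       (procedure-potential 3≤d wf (≤-trans (s≤s 1≤d) d<m) procedure)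
  in  ≤-trans |S|≤7m (*-monoˡ-≤ m (*-monoʳ-≤ 7 1≤d))
    , (begin
        arcsWithin G′ S          ≤⟨ arcsWithin≤sum-outdeg G′ S ⟩
        sum (map (outdeg G′) S) ≤⟨ sum-map≤*length (procedure-outdeg≤ procedure) ⟩
        d * length S            ≤⟨ *-monoʳ-≤ d |S|≤7m ⟩
        d * (7 * m)             ≡⟨ trans (sym (*-assoc d 7 m)) (cong (_* m) (*-comm d 7)) ⟩
        7 * d * m               ∎)
  where
  open ≤-Reasoning
  1≤d : 1 ≤ d
  1≤d = ≤-trans (s≤s z≤n) 4≤d
  3≤d : 3 ≤ d
  3≤d = ≤-trans (n≤1+n 3) 4≤d
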